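{- Let $k \geq 1$ and $n \geq 2k+2$, and let $G = C_n^k$. Then there is a colouring of the vertices of $G$ with at most 3 colours such that no three vertices of the same colour induce a path $P_3$ in $G$.
   Context: For $k \geq 1$, the power of a cycle $C_n^k$ is the simple graph with vertex set $\{v_0,\dots,v_{n-1}\}$ in which $v_i v_j$ ($i\neq j$) is an edge if and only if $\min\{(j-i) \bmod n, (i-j) \bmod n\} \leq k$. -}

module Defs where

open import Data.Nat using (ℕ; _+_; _∸_; _≤_; _⊓_; NonZero)
open import Data.Nat.DivMod using (_%_)
open import Data.Fin using (Fin; toℕ)
open import Data.Product using (_×_)
open import Relation.Binary.PropositionalEquality using (_≡_)
open import Relation.Nullary using (¬_)

cdist : (n : ℕ) → .{{NonZero n}} → Fin n → Fin n → ℕ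
cdist n i j = ((toℕ j + (n ∸ toℕ i)) % n) ⊓ ((toℕ i + (n ∸ toℕ j)) % n)

Adj : (n k : ℕ) → .{{NonZero n}} → Fin n → Fin n → Set
Adj n k i j = ¬ (i ≡ j) × cdist n i j ≤ k

InducedP3 : (n k : ℕ) → .{{NonZero n}} → Fin n → Fin n → Fin n → Set
InducedP3 n k a b c = Adj n k a b × Adj n k b c × ¬ (a ≡ c) × ¬ Adj n k a c

-- Cut the cycle into blocks of k + 1 consecutive vertices; each block is a clique of C_n^k.
-- Colour the blocks 0, 1, 0, 1, … and give colour 2 to the single block M = 2⌊n/(2(k+1))⌋,
-- after which at most one further block remains.  Two adjacent vertices in different blocks
-- lie in consecutive blocks or, across the wrap-around, in block 0 and one of the last three
-- blocks, and in both cases get different colours.  So every colour class is a disjoint union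
-- of pairwise non-adjacent cliques, and such a union contains no induced P₃.
module Submission where

open import Defs
open import Data.Nat using (ℕ; zero; suc; _+_; _*_; _∸_; _≤_; _<_; _≟_; NonZero; s≤s⁻¹)
open import Data.Nat.Properties
open import Data.Nat.DivMod
open import Data.Fin using (Fin; toℕ)
open import Data.Fin.Properties using (toℕ<n)
open import Data.Product using (Σ; _×_; _,_)
open import Data.Sum using (_⊎_; inj₁; inj₂)
open import Data.Empty using (⊥; ⊥-elim)
open import Function using (_∘_)
open import Relation.Binary using (tri<; tri≈; tri>)
open import Relation.Binary.PropositionalEquality
open import Relation.Nullary using (¬_; yes; no)

parity : ℕ → Fin 3
parity zero = Fin.zero
parity (suc zero) = Fin.suc Fin.zero
parity (suc (suc b)) = parity b

parity-suc : ∀ b → parity b ≢ parity (suc b)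
parity-suc zero ()
parity-suc (suc zero) ()
parity-suc (suc (suc b)) = parity-suc b

parity≢2 : ∀ b → parity b ≢ Fin.suc (Fin.suc Fin.zero)
parity≢2 zero ()
parity≢2 (suc zero) ()
parity≢2 (suc (suc b)) = parity≢2 b

parity-double : ∀ t → parity (t + t) ≡ Fin.zero
parity-double zero = refl
parity-double (suc t) rewrite +-suc t t = parity-double t

parity-gap : ∀ {b b'} → b < b' → parity b ≡ parity b' → 2 + b ≤ b'
parity-gap {b} {b'} b<b' eq with suc b ≟ b'
... | yes refl = ⊥-elim (parity-suc b eq)
... | no b+1≢b' = ≤∧≢⇒< b<b' b+1≢b'

blockColour : ℕ → ℕ → Fin 3
blockColour m b with b ≟ m
... | yes _ = Fin.suc (Fin.suc Fin.zero)
... | no _ = parity b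

blockColour-≡ : ∀ {m b b'} → b ≢ b' → blockColour m b ≡ blockColour m b' →
                b ≢ m × b' ≢ m × parity b ≡ parity b'
blockColour-≡ {m} {b} {b'} b≢b' eq with b ≟ m | b' ≟ m
... | yes b≡m | yes b'≡m = ⊥-elim (b≢b' (trans b≡m (sym b'≡m)))
... | yes _   | no _     = ⊥-elim (parity≢2 b' (sym eq))
... | no _    | yes _    = ⊥-elim (parity≢2 b eq)
... | no b≢m  | no b'≢m  = b≢m , b'≢m , eq

blockColour-gap : ∀ {m b b'} → b < b' → blockColour m b ≡ blockColour m b' → 2 + b ≤ b'
blockColour-gap b<b' eq with blockColour-≡ (<⇒≢ b<b') eq
... | _ , _ , same-parity = parity-gap b<b' same-parity

-- M = t + t is even, so blocks M - 1 and M + 1 are odd and block M has a colour of its own: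
-- none of the last three blocks shares the colour of block 0.
blockColour-wrap : ∀ t {b} → 0 ≢ b → b < 2 + (t + t) →
                   blockColour (t + t) 0 ≡ blockColour (t + t) b → 2 + b ≤ t + t
blockColour-wrap t {b} 0≢b b<2+M eq with blockColour-≡ 0≢b eq
... | _ , b≢M , same-parity = parity-gap b<M same-parity-M
  where
  M = t + t
  same-parity-M : parity b ≡ parity M
  same-parity-M = trans (sym same-parity) (sym (parity-double t))
  b≢1+M : b ≢ suc M
  b≢1+M refl = parity-suc M (sym same-parity-M)
  b<M : b < M
  b<M = ≤∧≢⇒< (s≤s⁻¹ (≤∧≢⇒< (s≤s⁻¹ b<2+M) b≢1+M)) b≢M

module _ (d : ℕ) .{{_ : NonZero d}} where

  <block-end : ∀ x → x < d + x / d * d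
  <block-end x = begin-strict
    x                   ≡⟨ m≡m%n+[m/n]*n x d ⟩
    x % d + x / d * d   <⟨ +-monoˡ-< (x / d * d) (m%n<n x d) ⟩
    d + x / d * d       ∎
    where open ≤-Reasoning

  sameBlock⇒< : ∀ {x y} → x ≤ y → x / d ≡ y / d → y < x + d
  sameBlock⇒< {x} {y} x≤y eq = begin-strict
    y               <⟨ <block-end y ⟩
    d + y / d * d   ≡⟨ cong (λ q → d + q * d) (sym eq) ⟩
    d + x / d * d   ≤⟨ +-monoʳ-≤ d (m/n*n≤m x d) ⟩
    d + x           ≡⟨ +-comm d x ⟩
    x + d           ∎
    where open ≤-Reasoning

  blockGap : ∀ {x b} → 2 + x / d ≤ b → x + d < b * d
  blockGap {x} {b} gap = begin-strict
    x + d                 <⟨ +-monoˡ-< d (<block-end x) ⟩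
    d + x / d * d + d     ≡⟨ +-comm (d + x / d * d) d ⟩
    (2 + x / d) * d       ≤⟨ *-monoˡ-≤ d gap ⟩
    b * d                 ∎
    where open ≤-Reasoning

module _ (n : ℕ) .{{_ : NonZero n}} where

  -- The clockwise distance from x to y; cdist n i j is by definition
  -- offset (toℕ i) (toℕ j) ⊓ offset (toℕ j) (toℕ i).
  offset : ℕ → ℕ → ℕ
  offset x y = (y + (n ∸ x)) % n

  offset-≤ : ∀ {x y} → x ≤ y → y < n → offset x y ≡ y ∸ x
  offset-≤ {x} {y} x≤y y<n = begin
    (y + (n ∸ x)) % n   ≡⟨ cong (_% n) (+-∸-assoc y x≤n) ⟨
    (y + n ∸ x) % n     ≡⟨ cong (_% n) (+-∸-comm n x≤y) ⟩
    (y ∸ x + n) % n     ≡⟨ [m+n]%n≡m%n (y ∸ x) n ⟩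
    (y ∸ x) % n         ≡⟨ m<n⇒m%n≡m (≤-<-trans (m∸n≤m y x) y<n) ⟩
    y ∸ x               ∎
    where
    open ≡-Reasoning
    x≤n = ≤-trans x≤y (<⇒≤ y<n)

  offset-> : ∀ {x y} → y < x → x < n → offset x y ≡ y + (n ∸ x)
  offset-> {x} {y} y<x x<n = m<n⇒m%n≡m (begin-strict
    y + (n ∸ x)   <⟨ +-monoˡ-< (n ∸ x) y<x ⟩
    x + (n ∸ x)   ≡⟨ m+[n∸m]≡n (<⇒≤ x<n) ⟩
    n             ∎)
    where open ≤-Reasoning

  cdist-comm : ∀ i j → cdist n i j ≡ cdist n j i
  cdist-comm i j = ⊓-comm (offset (toℕ i) (toℕ j)) (offset (toℕ j) (toℕ i))

  ≤⇒cdist≤ : ∀ {k} i j → toℕ i ≤ toℕ j → toℕ j ≤ toℕ i + k → cdist n i j ≤ k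
  ≤⇒cdist≤ {k} i j i≤j j≤i+k = begin
    cdist n i j                 ≤⟨ m⊓n≤m _ _ ⟩
    offset (toℕ i) (toℕ j)      ≡⟨ offset-≤ i≤j (toℕ<n j) ⟩
    toℕ j ∸ toℕ i               ≤⟨ m≤n+o⇒m∸n≤o (toℕ j) (toℕ i) j≤i+k ⟩
    k                           ∎
    where open ≤-Reasoning

  cdist≤⇒≤ : ∀ {k} i j → toℕ i < toℕ j → cdist n i j ≤ k →
             toℕ j ≤ toℕ i + k ⊎ n + toℕ i ≤ toℕ j + k
  cdist≤⇒≤ {k} i j i<j cdist≤k
    with ⊓-sel (offset (toℕ i) (toℕ j)) (offset (toℕ j) (toℕ i))
  ... | inj₁ eq = inj₁ (begin
    toℕ j                         ≡⟨ m∸n+n≡m (<⇒≤ i<j) ⟨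
    toℕ j ∸ toℕ i + toℕ i         ≡⟨ cong (_+ toℕ i) (offset-≤ (<⇒≤ i<j) (toℕ<n j)) ⟨
    offset (toℕ i) (toℕ j) + toℕ i ≤⟨ +-monoˡ-≤ (toℕ i) (subst (_≤ k) eq cdist≤k) ⟩
    k + toℕ i                     ≡⟨ +-comm k (toℕ i) ⟩
    toℕ i + k                     ∎)
    where open ≤-Reasoning
  ... | inj₂ eq = inj₂ (begin
    n + toℕ i                     ≡⟨ +-comm n (toℕ i) ⟩
    toℕ i + n                     ≡⟨ cong (toℕ i +_) (m∸n+n≡m (<⇒≤ (toℕ<n j))) ⟨
    toℕ i + (n ∸ toℕ j + toℕ j)   ≡⟨ +-assoc (toℕ i) (n ∸ toℕ j) (toℕ j) ⟨
    toℕ i + (n ∸ toℕ j) + toℕ j   ≡⟨ cong (_+ toℕ j) (offset-> i<j (toℕ<n j)) ⟨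
    offset (toℕ j) (toℕ i) + toℕ j ≤⟨ +-monoˡ-≤ (toℕ j) (subst (_≤ k) eq cdist≤k) ⟩
    k + toℕ j                     ≡⟨ +-comm k (toℕ j) ⟩
    toℕ j + k                     ∎)
    where open ≤-Reasoning

module BlockColouring (n k : ℕ) .{{_ : NonZero n}} where

  d : ℕ
  d = suc k

  t : ℕ
  t = n / (d + d)

  M : ℕ
  M = t + t

  M*d≤n : M * d ≤ n
  M*d≤n = begin
    (t + t) * d     ≡⟨ *-distribʳ-+ d t t ⟩
    t * d + t * d   ≡⟨ *-distribˡ-+ t d d ⟨
    t * (d + d)     ≤⟨ m/n*n≤m n (d + d) ⟩
    n               ∎
    where open ≤-Reasoning

  n<[2+M]*d : n < (2 + M) * d
  n<[2+M]*d = begin-strict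
    n                     <⟨ <block-end (d + d) n ⟩
    d + d + t * (d + d)   ≡⟨ +-assoc d d (t * (d + d)) ⟩
    d + (d + t * (d + d)) ≡⟨ cong (λ m → d + (d + m)) (*-distribˡ-+ t d d) ⟩
    d + (d + (t * d + t * d)) ≡⟨ cong (λ m → d + (d + m)) (*-distribʳ-+ d t t) ⟨
    (2 + M) * d           ∎
    where open ≤-Reasoning

  sameBlock⇒≤ : ∀ {x y} → x ≤ y → x / d ≡ y / d → y ≤ x + k
  sameBlock⇒≤ {x} {y} x≤y eq = s≤s⁻¹ (subst (y <_) (+-suc x k) (sameBlock⇒< d x≤y eq))

  sameColour⇒sameBlock : ∀ {x y} → x < y → y < n →
                         blockColour M (x / d) ≡ blockColour M (y / d) →
                         y ≤ x + k ⊎ n + x ≤ y + k → x / d ≡ y / d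
  sameColour⇒sameBlock {x} {y} x<y y<n eq near with x / d ≟ y / d
  ... | yes same = same
  ... | no differ = ⊥-elim (separated near)
    where
    open ≤-Reasoning

    separated : y ≤ x + k ⊎ n + x ≤ y + k → ⊥
    separated (inj₁ y≤x+k) = <-irrefl refl (begin-strict
      x + d           <⟨ blockGap d (blockColour-gap x/d<y/d eq) ⟩
      y / d * d       ≤⟨ m/n*n≤m y d ⟩
      y               ≤⟨ y≤x+k ⟩
      x + k           <⟨ +-monoʳ-< x (n<1+n k) ⟩
      x + d           ∎)
      where x/d<y/d = ≤∧≢⇒< (/-monoˡ-≤ d (<⇒≤ x<y)) differ
    separated (inj₂ n+x≤y+k) = <-irrefl refl (begin-strict
      y + d           <⟨ blockGap d y/d+2≤M ⟩
      M * d           ≤⟨ M*d≤n ⟩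
      n               ≤⟨ m≤m+n n x ⟩
      n + x           ≤⟨ n+x≤y+k ⟩
      y + k           <⟨ +-monoʳ-< y (n<1+n k) ⟩
      y + d           ∎)
      where
      x<d : x < d
      x<d = +-cancelˡ-< n x d (begin-strict
        n + x   ≤⟨ n+x≤y+k ⟩
        y + k   <⟨ +-monoˡ-< k y<n ⟩
        n + k   <⟨ +-monoʳ-< n (n<1+n k) ⟩
        n + d   ∎)
      x/d≡0 : x / d ≡ 0
      x/d≡0 = m<n⇒m/n≡0 x<d
      y/d+2≤M : 2 + y / d ≤ M
      y/d+2≤M = blockColour-wrap t
        (differ ∘ trans x/d≡0)
        (m<n*o⇒m/o<n (<-trans y<n n<[2+M]*d))
        (subst (λ b → blockColour M b ≡ blockColour M (y / d)) x/d≡0 eq)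

  colour : Fin n → Fin 3
  colour i = blockColour M (toℕ i / d)

  adjacent⇒sameBlock : ∀ i j → Adj n k i j → colour i ≡ colour j → toℕ i / d ≡ toℕ j / d
  adjacent⇒sameBlock i j (_ , i~j) eq with <-cmp (toℕ i) (toℕ j)
  ... | tri< i<j _ _ = sameColour⇒sameBlock i<j (toℕ<n j) eq (cdist≤⇒≤ n i j i<j i~j)
  ... | tri≈ _ i≡j _ = cong (_/ d) i≡j
  ... | tri> _ _ j<i = sym (sameColour⇒sameBlock j<i (toℕ<n i) (sym eq)
                         (cdist≤⇒≤ n j i j<i (subst (_≤ k) (cdist-comm n i j) i~j)))

  sameBlock⇒adjacent : ∀ i j → toℕ i / d ≡ toℕ j / d → i ≢ j → Adj n k i j
  sameBlock⇒adjacent i j eq i≢j with ≤-total (toℕ i) (toℕ j)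
  ... | inj₁ i≤j = i≢j , ≤⇒cdist≤ n i j i≤j (sameBlock⇒≤ i≤j eq)
  ... | inj₂ j≤i = i≢j , subst (_≤ k) (cdist-comm n j i) (≤⇒cdist≤ n j i j≤i (sameBlock⇒≤ j≤i (sym eq)))

  colour-noInducedP3 : ∀ a b c → colour a ≡ colour b → colour b ≡ colour c → ¬ InducedP3 n k a b c
  colour-noInducedP3 a b c ab bc (a~b , b~c , a≢c , a≁c) =
    a≁c (sameBlock⇒adjacent a c (trans (adjacent⇒sameBlock a b a~b ab) (adjacent⇒sameBlock b c b~c bc)) a≢c)

-- The colouring works for every k and n.
lemma3 : (k n : ℕ) → 1 ≤ k → 2 * k + 2 ≤ n → .{{_ : NonZero n}} →
    Σ (Fin n → Fin 3) λ col →
      (a b c : Fin n) → col a ≡ col b → col b ≡ col c → ¬ InducedP3 n k a b c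
lemma3 k n _ _ = colour , colour-noInducedP3
  where open BlockColouring n k
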